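{- Let $\mathfrak{F}$ be a CI frame closed under copying, marginalization, intersection, lifting, and ascetic extension, let $N$ be a finite set and $\mathcal{M}\subseteq\mathbb{S}(N)$. Define $\mathcal{M}_0=\mathcal{M}$ and $\mathcal{M}_{i+1}=\bigcup_{L\subseteq N}\mathfrak{F}^{\mathrm{sa}}(\mathcal{M}_i|L)$ for $i=0,1,\dots$. Then $\mathcal{M}_0\subseteq\mathcal{M}_1\subseteq\cdots$, there is $k$ with $\mathcal{M}_{k+1}=\mathcal{M}_k$, and for the first such $k$ the model $\mathcal{M}_k$ equals $\mathrm{cl}_{\mathfrak{F}^{\mathrm{sa}}(N)}(\mathcal{M})$, the smallest element of $\mathfrak{F}^{\mathrm{sa}}(N)$ containing $\mathcal{M}$.
   Context: For a finite set $N$, $\mathbb{S}(N)$ denotes the set of all CI statements $ij|K$ with $i,j\in N$ distinct and $K\subseteq N\setminus\{i,j\}$, with $ij|K$ and $ji|K$ identified; juxtaposition denotes union. A CI model over $N$ is a subset of $\mathbb{S}(N)$ (also a model over any superset of $N$). A CI frame $\mathfrak{F}$ assigns to every finite set $N$ a set $\mathfrak{F}(N)$ of models over $N$ with $\mathbb{S}(N)\in\mathfrak{F}(N)$. Closure properties: copying (for bijections $\varphi:N\to M$ acting by $\varphi(ij|K)=\varphi(i)\varphi(j)|\varphi(K)$, $\mathcal{M}\in\mathfrak{F}(N)\Rightarrow\varphi(\mathcal{M})\in\mathfrak{F}(M)$); marginalization ($\mathcal{M}\in\mathfrak{F}(N)$, $M\subseteq N\Rightarrow\mathcal{M}^{\downarrow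 M}:=\mathcal{M}\cap\mathbb{S}(M)\in\mathfrak{F}(M)$); intersection ($\mathcal{M},\mathcal{A}\in\mathfrak{F}(N)\Rightarrow\mathcal{M}\cap\mathcal{A}\in\mathfrak{F}(N)$); lifting ($\mathcal{M}\in\mathfrak{F}(N)$, $N\subseteq O\Rightarrow\mathcal{M}_{N\uparrow O}\in\mathfrak{F}(O)$, where $\mathcal{M}_{N\uparrow O}=\{ij|K\in\mathbb{S}(O):\{i,j\}\cap(O\setminus N)\ne\emptyset\text{ or }ij|(K\cap N)\in\mathcal{M}\}$); ascetic extension ($N\subseteq M\Rightarrow\mathfrak{F}(N)\subseteq\mathfrak{F}(M)$). For pairwise disjoint $I,J,C$, $I\perp J\,|\,C\,[\mathcal{Z}]$ means $ij|L'\in\mathcal{Z}$ for all $i\in I$, $j\in J$, $C\subseteq L'\subseteq(I\cup J\cup C)\setminus\{i,j\}$. $\mathcal{M}\in\mathfrak{F}(N)$ is self-adhesive at $L\subseteq N$ relative to $\mathfrak{F}$ if for every bijection $\varphi:N\to M$ with $N\cap M=L$ and $\varphi|_L=\mathrm{id}_L$ there is $\mathcal{Z}\in\mathfrak{F}(N\cup M)$ with $\mathcal{Z}^{\downarrow N}=\mathcal{M}$, $\mathcal{Z}^{\downarrow M}=\varphi(\mathcal{M})$, and $(N\setminus M)\perp(M\setminus N)\,|\,L\,[\mathcal{Z}]$. $\mathfrak{F}^{\mathrm{sa}}(N)$ is the set of $\mathcal{M}\in\mathfrak{F}(N)$ self-adhesive at every $L\subseteq N$. For $\mathcal{M}\subseteq\mathbb{S}(N)$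 and $L\subseteq N$, $\mathfrak{F}^{\mathrm{sa}}(\mathcal{M}|L)$ denotes the least $\mathcal{A}\in\mathfrak{F}(N)$ with $\mathcal{M}\subseteq\mathcal{A}$ that is self-adhesive at $L$ relative to $\mathfrak{F}$ (under the stated hypotheses on $\mathfrak{F}$ this least model exists). -}

module Defs where

open import Data.Nat using (ℕ; zero; suc; _+_; compare; less; equal; greater)
open import Data.List using (List; []; _∷_)
open import Data.Bool using (Bool; true; false)
open import Data.Maybe using (Maybe; just; nothing)
open import Data.Product using (∃; _×_; _,_)
open import Data.Sum using (_⊎_)
open import Data.Empty using (⊥)
open import Data.Unit using (⊤)
open import Relation.Nullary using (¬_)
open import Relation.Binary.PropositionalEquality using (_≡_; _≢_)
open import Function.Bundles using (_⇔_)

-- Finite subsets of ℕ (the ambient universe of "finite sets").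
-- Canonical "gap" encoding: [g₀, g₁, g₂, …] encodes
-- { g₀ , g₀+1+g₁ , g₀+1+g₁+1+g₂ , … }.  Every finite subset of ℕ has
-- exactly one code, so propositional equality of codes is equality of sets.

FSet : Set
FSet = List ℕ

infix 4 _∈ₛ_ _⊆ₛ_
_∈ₛ_ : ℕ → FSet → Set
x ∈ₛ [] = ⊥
zero ∈ₛ (zero ∷ gs) = ⊤
zero ∈ₛ (suc g ∷ gs) = ⊥
suc x ∈ₛ (zero ∷ gs) = x ∈ₛ gs
suc x ∈ₛ (suc g ∷ gs) = x ∈ₛ (g ∷ gs)

_⊆ₛ_ : FSet → FSet → Set
A ⊆ₛ B = ∀ x → x ∈ₛ A → x ∈ₛ B

IsUnion : FSet → FSet → FSet → Set
IsUnion N M U = ∀ x → x ∈ₛ U ⇔ (x ∈ₛ N ⊎ x ∈ₛ M)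

IsInter : FSet → FSet → FSet → Set
IsInter K N K' = ∀ x → x ∈ₛ K' ⇔ (x ∈ₛ K × x ∈ₛ N)

-- CI statements.  The statement ij|K = ji|K is stored canonically as
-- (lo , gap , K) with lo = min(i,j) and max(i,j) = suc (lo + gap).

record CI : Set where
  constructor ci
  field
    lo   : ℕ
    gap  : ℕ
    cond : FSet

open CI public

hi : CI → ℕ
hi s = suc (lo s + gap s)

norm : ℕ → ℕ → FSet → Maybe CI
norm i j K with compare i j
... | less _ k = just (ci i k K)
... | equal _ = nothing
... | greater _ k = just (ci j k K)

InS : FSet → CI → Set
InS N s = lo s ∈ₛ N × hi s ∈ₛ N × cond s ⊆ₛ N × ¬ (lo s ∈ₛ cond s) × ¬ (hi s ∈ₛ cond s)

Model : Set
Model = CI → Bool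

infix 4 _∈ᴹ_ _⊆ᴹ_ _≐_
_∈ᴹ_ : CI → Model → Set
s ∈ᴹ A = A s ≡ true

_⊆ᴹ_ : Model → Model → Set
A ⊆ᴹ B = ∀ s → s ∈ᴹ A → s ∈ᴹ B

_≐_ : Model → Model → Set
A ≐ B = ∀ s → A s ≡ B s

Holds : Model → ℕ → ℕ → FSet → Set
Holds A i j K = ∃ λ s → norm i j K ≡ just s × s ∈ᴹ A

OverN : FSet → Model → Set
OverN N A = ∀ s → s ∈ᴹ A → InS N s

IsFull : FSet → Model → Set
IsFull N B = ∀ s → s ∈ᴹ B ⇔ InS N s

IsMarg : Model → FSet → Model → Set
IsMarg A M B = ∀ s → s ∈ᴹ B ⇔ (s ∈ᴹ A × InS M s)

IsMeet : Model → Model → Model → Set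
IsMeet A A' B = ∀ s → s ∈ᴹ B ⇔ (s ∈ᴹ A × s ∈ᴹ A')

IsLift : FSet → FSet → Model → Model → Set
IsLift N O A B = ∀ s → s ∈ᴹ B ⇔
  (InS O s × ((¬ (lo s ∈ₛ N) ⊎ ¬ (hi s ∈ₛ N))
              ⊎ (∃ λ K' → IsInter (cond s) N K' × ci (lo s) (gap s) K' ∈ᴹ A)))

IsBij : (ℕ → ℕ) → FSet → FSet → Set
IsBij φ N M =
  (∀ x → x ∈ₛ N → φ x ∈ₛ M)
  × (∀ x y → x ∈ₛ N → y ∈ₛ N → φ x ≡ φ y → x ≡ y)
  × (∀ y → y ∈ₛ M → ∃ λ x → x ∈ₛ N × φ x ≡ y)

IsImage : (ℕ → ℕ) → FSet → FSet → Set
IsImage φ K K' = ∀ y → y ∈ₛ K' ⇔ (∃ λ x → x ∈ₛ K × φ x ≡ y)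

CopyStmt : (ℕ → ℕ) → Model → CI → Set
CopyStmt φ A t = ∃ λ s → s ∈ᴹ A × ∃ λ K' → IsImage φ (cond s) K'
                   × norm (φ (lo s)) (φ (hi s)) K' ≡ just t

IsCopy : (ℕ → ℕ) → Model → Model → Set
IsCopy φ A B = ∀ t → t ∈ᴹ B ⇔ CopyStmt φ A t

record CIFrame : Set₁ where
  field
    mem  : FSet → Model → Set
    ext  : ∀ {N A B} → mem N A → A ≐ B → mem N B    -- 𝔉(N) is a set of sets
    over : ∀ {N A} → mem N A → OverN N A
    full : ∀ N B → IsFull N B → mem N B

open CIFrame public

CopyClosed : CIFrame → Set
CopyClosed F = ∀ N M φ A B → IsBij φ N M → mem F N A → IsCopy φ A B → mem F M B

MargClosed : CIFrame → Set
MargClosed F = ∀ N M A B → mem F N A → M ⊆ₛ N → IsMarg A M B → mem F M B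

InterClosed : CIFrame → Set
InterClosed F = ∀ N A A' B → mem F N A → mem F N A' → IsMeet A A' B → mem F N B

LiftClosed : CIFrame → Set
LiftClosed F = ∀ N O A B → mem F N A → N ⊆ₛ O → IsLift N O A B → mem F O B

AsceticClosed : CIFrame → Set
AsceticClosed F = ∀ N M A → N ⊆ₛ M → mem F N A → mem F M A

CondIndep : (I J C : ℕ → Set) → Model → Set
CondIndep I J C Z = ∀ i j L' → I i → J j
  → (∀ x → C x → x ∈ₛ L')
  → (∀ x → x ∈ₛ L' → (I x ⊎ J x ⊎ C x) × x ≢ i × x ≢ j)
  → Holds Z i j L'

SelfAdhesive : CIFrame → FSet → FSet → Model → Set
SelfAdhesive F N L A = ∀ M φ → IsBij φ N M
  → (∀ x → (x ∈ₛ N × x ∈ₛ M) ⇔ x ∈ₛ L)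
  → (∀ x → x ∈ₛ L → φ x ≡ x)
  → ∃ λ U → IsUnion N M U × ∃ λ Z → mem F U Z
      × IsMarg Z N A
      × (∀ t → (t ∈ᴹ Z × InS M t) ⇔ CopyStmt φ A t)
      × CondIndep (λ x → x ∈ₛ N × ¬ (x ∈ₛ M)) (λ x → x ∈ₛ M × ¬ (x ∈ₛ N))
                  (λ x → x ∈ₛ L) Z

IsLeastSA : CIFrame → FSet → Model → FSet → Model → Set
IsLeastSA F N 𝓜 L A =
  (mem F N A × 𝓜 ⊆ᴹ A × SelfAdhesive F N L A)
  × (∀ B → mem F N B → 𝓜 ⊆ᴹ B → SelfAdhesive F N L B → A ⊆ᴹ B)

InFsa : CIFrame → FSet → Model → Set
InFsa F N A = mem F N A × (∀ L → L ⊆ₛ N → SelfAdhesive F N L A)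

IsClosureSA : CIFrame → FSet → Model → Model → Set
IsClosureSA F N 𝓜 A =
  (InFsa F N A × 𝓜 ⊆ᴹ A) × (∀ B → InFsa F N B → 𝓜 ⊆ᴹ B → A ⊆ᴹ B)

{-# OPTIONS --safe #-}
-- Each 𝔉^sa(𝓜ᵢ|L) contains 𝓜ᵢ, so the chain ascends (take L = ∅), and lies below every
-- member of 𝔉^sa(N) containing 𝓜ᵢ, so by induction the whole chain lies below every
-- member of 𝔉^sa(N) containing 𝓜.  All 𝓜ᵢ are subsets of the finite set 𝕊(N), so the
-- number of statements they contain is bounded and the chain must stop.  At a fixed point
-- 𝓜ₖ = 𝔉^sa(𝓜ₖ|L) for every L ⊆ N, hence 𝓜ₖ ∈ 𝔉(N) is self-adhesive everywhere and is the
-- closure.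
module Submission where

open import Defs
open import Data.Nat using (ℕ; zero; suc; _+_; _≤_; _<_; z≤n; s≤s)
open import Data.Nat.Properties
  using (≤-refl; ≤-<-trans; <-trans; <⇒≱; n<1+n; m≤n⇒m≤1+n; m≤n+m;
         +-mono-≤; +-mono-<-≤; +-mono-≤-<)
open import Data.Bool using (Bool; true; false)
import Data.Bool.Properties as Bool
open import Data.List using (List; []; _∷_; _++_; map; length; upTo; cartesianProduct; cartesianProductWith)
open import Data.List.Membership.Propositional using (_∈_)
open import Data.List.Membership.Propositional.Properties
  using (∈-map⁺; ∈-++⁺ˡ; ∈-++⁺ʳ; ∈-upTo⁺; ∈-cartesianProduct⁺; ∈-cartesianProductWith⁺)
open import Data.List.Relation.Unary.All as All using (All; all?)
open import Data.List.Relation.Unary.All.Properties using (¬All⇒Any¬)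
open import Data.List.Relation.Unary.Any using (Any; here; there)
open import Data.Product using (∃; _×_; _,_; proj₁; proj₂; uncurry)
open import Data.Sum using (_⊎_; inj₁; inj₂; [_,_]′)
open import Data.Unit using (tt)
open import Relation.Nullary using (¬_; yes; no; contradiction)
open import Relation.Binary.PropositionalEquality using (_≡_; _≢_; refl; sym; trans)
open import Function using (id)
open import Function.Bundles using (_⇔_; mk⇔; Equivalence)

open Equivalence

∅⊆ₛ : ∀ N → [] ⊆ₛ N
∅⊆ₛ _ _ ()

-- One more than the largest element of K, and 0 for K = ∅.
bound : FSet → ℕ
bound []       = 0
bound (g ∷ gs) = suc g + bound gs

∈ₛ⇒<bound : ∀ {x} K → x ∈ₛ K → x < bound K
∈ₛ⇒<bound {zero}  (zero  ∷ gs) _    = s≤s z≤n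
∈ₛ⇒<bound {suc x} (zero  ∷ gs) x∈gs = s≤s (∈ₛ⇒<bound gs x∈gs)
∈ₛ⇒<bound {suc x} (suc g ∷ gs) x∈K  = s≤s (∈ₛ⇒<bound (g ∷ gs) x∈K)

largest-∈ₛ : ∀ g gs → g + bound gs ∈ₛ (g ∷ gs)
largest-∈ₛ zero    []       = tt
largest-∈ₛ zero    (h ∷ hs) = largest-∈ₛ h hs
largest-∈ₛ (suc g) gs       = largest-∈ₛ g gs

⊆ₛ⇒bound≤ : ∀ {K N} → K ⊆ₛ N → bound K ≤ bound N
⊆ₛ⇒bound≤ {[]}           _   = z≤n
⊆ₛ⇒bound≤ {g ∷ gs} {N} K⊆N = ∈ₛ⇒<bound N (K⊆N _ (largest-∈ₛ g gs))

shiftₛ : FSet → FSet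
shiftₛ []       = []
shiftₛ (g ∷ gs) = suc g ∷ gs

-- All K with bound K ≤ n: a nonempty K with bound K ≤ n + 1 is 0 ∷ K′, i.e. {0} ∪ (K′ + 1),
-- or shiftₛ K′ = K′ + 1, for some K′ with bound K′ ≤ n.
fsetsBelow : ℕ → List FSet
fsetsBelow zero    = [] ∷ []
fsetsBelow (suc n) = [] ∷ (map (zero ∷_) (fsetsBelow n) ++ map shiftₛ (fsetsBelow n))

∈-fsetsBelow : ∀ n K → bound K ≤ n → K ∈ fsetsBelow n
∈-fsetsBelow zero    []           _       = here refl
∈-fsetsBelow (suc n) []           _       = here refl
∈-fsetsBelow (suc n) (zero ∷ gs)  (s≤s b) =
  there (∈-++⁺ˡ (∈-map⁺ (zero ∷_) (∈-fsetsBelow n gs b)))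
∈-fsetsBelow (suc n) (suc g ∷ gs) (s≤s b) =
  there (∈-++⁺ʳ _ (∈-map⁺ shiftₛ (∈-fsetsBelow n (g ∷ gs) b)))

statementsBelow : ℕ → List CI
statementsBelow n =
  cartesianProductWith (λ a → uncurry (ci a)) (upTo n) (cartesianProduct (upTo n) (fsetsBelow n))

InS⇒∈statementsBelow : ∀ N s → InS N s → s ∈ statementsBelow (bound N)
InS⇒∈statementsBelow N (ci a b K) (a∈N , hi∈N , K⊆N , _ , _) =
  ∈-cartesianProductWith⁺ (λ a → uncurry (ci a)) (∈-upTo⁺ a<n)
    (∈-cartesianProduct⁺ (∈-upTo⁺ b<n) (∈-fsetsBelow _ K (⊆ₛ⇒bound≤ {K} {N} K⊆N)))
  where
  a<n : a < bound N
  a<n = ∈ₛ⇒<bound N a∈N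
  b<n : b < bound N
  b<n = ≤-<-trans (m≤n+m b a) (<-trans (n<1+n _) (∈ₛ⇒<bound N hi∈N))

⇒-antisym : ∀ {a b} → (a ≡ true → b ≡ true) → (b ≡ true → a ≡ true) → a ≡ b
⇒-antisym {true}          a⇒b _   = sym (a⇒b refl)
⇒-antisym {false} {true}  _   b⇒a = b⇒a refl
⇒-antisym {false} {false} _   _   = refl

⊆ᴹ-antisym : ∀ {A B} → A ⊆ᴹ B → B ⊆ᴹ A → A ≐ B
⊆ᴹ-antisym A⊆B B⊆A s = ⇒-antisym (A⊆B s) (B⊆A s)

indicator : Bool → ℕ
indicator true  = 1
indicator false = 0

indicator-mono : ∀ {a b} → (a ≡ true → b ≡ true) → indicator a ≤ indicator b
indicator-mono {false} _    = z≤n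
indicator-mono {true}  a⇒b rewrite a⇒b refl = ≤-refl

indicator-strict : ∀ {a b} → (a ≡ true → b ≡ true) → b ≢ a → indicator a < indicator b
indicator-strict {false} {false} _   b≢a = contradiction refl b≢a
indicator-strict {false} {true}  _   _   = s≤s z≤n
indicator-strict {true}          a⇒b b≢a = contradiction (a⇒b refl) b≢a

count : Model → List CI → ℕ
count A []      = 0
count A (s ∷ l) = indicator (A s) + count A l

count≤length : ∀ A l → count A l ≤ length l
count≤length A []      = z≤n
count≤length A (s ∷ l) with A s
... | true  = s≤s (count≤length A l)
... | false = m≤n⇒m≤1+n (count≤length A l)

count-mono : ∀ {A B} → A ⊆ᴹ B → ∀ l → count A l ≤ count B l
count-mono A⊆B []      = z≤n
count-mono A⊆B (s ∷ l) = +-mono-≤ (indicator-mono (A⊆B s)) (count-mono A⊆B l)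

count-strict : ∀ {A B l} → A ⊆ᴹ B → Any (λ s → B s ≢ A s) l → count A l < count B l
count-strict {l = s ∷ l} A⊆B (here Bs≢As) =
  +-mono-<-≤ (indicator-strict (A⊆B s) Bs≢As) (count-mono A⊆B l)
count-strict {l = s ∷ l} A⊆B (there differ) =
  +-mono-≤-< (indicator-mono (A⊆B s)) (count-strict A⊆B differ)

agree-or-count-grows : ∀ {A B} → A ⊆ᴹ B → ∀ l → All (λ s → B s ≡ A s) l ⊎ count A l < count B l
agree-or-count-grows {A} {B} A⊆B l with all? (λ s → B s Bool.≟ A s) l
... | yes agree = inj₁ agree
... | no ¬agree = inj₂ (count-strict A⊆B (¬All⇒Any¬ (λ s → B s Bool.≟ A s) l ¬agree))

bounded-ascent-halts : ∀ {P : ℕ → Set} (c : ℕ → ℕ) b → (∀ i → c i ≤ b)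
  → (∀ i → P i ⊎ c i < c (suc i)) → ∃ P
bounded-ascent-halts {P} c b c≤b step =
  [ id , (λ b<cb → contradiction (c≤b (suc b)) (<⇒≱ b<cb)) ]′ (ascent (suc b))
  where
  ascent : ∀ m → ∃ P ⊎ m ≤ c m
  ascent zero = inj₂ z≤n
  ascent (suc m) with ascent m | step m
  ... | inj₁ halt | _            = inj₁ halt
  ... | inj₂ _    | inj₁ Pm      = inj₁ (m , Pm)
  ... | inj₂ m≤cm | inj₂ cm<cm+1 = inj₂ (≤-<-trans m≤cm cm<cm+1)

chain-stabilises : (seq : ℕ → Model) (l : List CI) → (∀ i → seq i ⊆ᴹ seq (suc i))
  → (∀ i s → s ∈ᴹ seq i → s ∈ l) → ∃ λ k → seq (suc k) ≐ seq k
chain-stabilises seq l ascending supported =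
  bounded-ascent-halts (λ i → count (seq i) l) (length l) (λ i → count≤length (seq i) l) step
  where
  step : ∀ i → seq (suc i) ≐ seq i ⊎ count (seq i) l < count (seq (suc i)) l
  step i with agree-or-count-grows (ascending i) l
  ... | inj₂ grows = inj₂ grows
  ... | inj₁ agree = inj₁ (⊆ᴹ-antisym
          (λ s s∈next → trans (sym (All.lookup agree (supported (suc i) s s∈next))) s∈next)
          (ascending i))

CopyStmt-resp-≐ : ∀ {φ A B t} → A ≐ B → CopyStmt φ A t → CopyStmt φ B t
CopyStmt-resp-≐ A≐B (s , s∈A , K′ , K′-image , t-norm) =
  s , trans (sym (A≐B s)) s∈A , K′ , K′-image , t-norm

SelfAdhesive-resp-≐ : ∀ {F N L A B} → A ≐ B → SelfAdhesive F N L A → SelfAdhesive F N L B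
SelfAdhesive-resp-≐ {N = N} {A = A} {B} A≐B sa M φ bij shared fixes
  with sa M φ bij shared fixes
... | U , U-union , Z , Z-mem , Z↓N , Z↓M , independent =
  U , U-union , Z , Z-mem , Z↓N′ , Z↓M′ , independent
  where
  Z↓N′ : IsMarg Z N B
  Z↓N′ s = mk⇔ (λ s∈B → to (Z↓N s) (trans (A≐B s) s∈B))
               (λ s∈Z↓N → trans (sym (A≐B s)) (from (Z↓N s) s∈Z↓N))
  Z↓M′ : ∀ t → (t ∈ᴹ Z × InS M t) ⇔ CopyStmt φ B t
  Z↓M′ t = mk⇔ (λ t∈Z↓M → CopyStmt-resp-≐ A≐B (to (Z↓M t) t∈Z↓M))
               (λ t∈φB → from (Z↓M t) (CopyStmt-resp-≐ (λ s → sym (A≐B s)) t∈φB))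

module Iteration (F : CIFrame) (N : FSet) (𝓜 : Model) (𝓜-over : OverN N 𝓜)
  (Fsa : Model → FSet → Model)
  (Fsa-least-sa : ∀ A L → OverN N A → L ⊆ₛ N → IsLeastSA F N A L (Fsa A L))
  (seq : ℕ → Model) (seq-zero : seq zero ≐ 𝓜)
  (seq-suc : ∀ i s → s ∈ᴹ seq (suc i) ⇔ (∃ λ L → L ⊆ₛ N × s ∈ᴹ Fsa (seq i) L))
  where

  module _ {A L} (A-over : OverN N A) (L⊆N : L ⊆ₛ N) where

    Fsa-mem : mem F N (Fsa A L)
    Fsa-mem = proj₁ (proj₁ (Fsa-least-sa A L A-over L⊆N))

    ⊆Fsa : A ⊆ᴹ Fsa A L
    ⊆Fsa = proj₁ (proj₂ (proj₁ (Fsa-least-sa A L A-over L⊆N)))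

    Fsa-selfAdhesive : SelfAdhesive F N L (Fsa A L)
    Fsa-selfAdhesive = proj₂ (proj₂ (proj₁ (Fsa-least-sa A L A-over L⊆N)))

    Fsa-least : ∀ B → mem F N B → A ⊆ᴹ B → SelfAdhesive F N L B → Fsa A L ⊆ᴹ B
    Fsa-least = proj₂ (Fsa-least-sa A L A-over L⊆N)

  Fsa⊆seq-suc : ∀ i L → L ⊆ₛ N → Fsa (seq i) L ⊆ᴹ seq (suc i)
  Fsa⊆seq-suc i L L⊆N s s∈Fsa = from (seq-suc i s) (L , L⊆N , s∈Fsa)

  seq-over : ∀ i → OverN N (seq i)
  seq-over zero    s s∈seq = 𝓜-over s (trans (sym (seq-zero s)) s∈seq)
  seq-over (suc i) s s∈seq with to (seq-suc i s) s∈seq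
  ... | L , L⊆N , s∈Fsa = over F (Fsa-mem (seq-over i) L⊆N) s s∈Fsa

  seq-ascending : ∀ i → seq i ⊆ᴹ seq (suc i)
  seq-ascending i s s∈seq = Fsa⊆seq-suc i [] (∅⊆ₛ N) s (⊆Fsa (seq-over i) (∅⊆ₛ N) s s∈seq)

  𝓜⊆seq : ∀ i → 𝓜 ⊆ᴹ seq i
  𝓜⊆seq zero    s s∈𝓜 = trans (seq-zero s) s∈𝓜
  𝓜⊆seq (suc i) s s∈𝓜 = seq-ascending i s (𝓜⊆seq i s s∈𝓜)

  seq⊆InFsa : ∀ B → InFsa F N B → 𝓜 ⊆ᴹ B → ∀ i → seq i ⊆ᴹ B
  seq⊆InFsa B _ 𝓜⊆B zero s s∈seq = 𝓜⊆B s (trans (sym (seq-zero s)) s∈seq)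
  seq⊆InFsa B B∈Fsa@(B-mem , B-sa) 𝓜⊆B (suc i) s s∈seq with to (seq-suc i s) s∈seq
  ... | L , L⊆N , s∈Fsa =
    Fsa-least (seq-over i) L⊆N B B-mem (seq⊆InFsa B B∈Fsa 𝓜⊆B i) (B-sa L L⊆N) s s∈Fsa

  seq-stabilises : ∃ λ k → seq (suc k) ≐ seq k
  seq-stabilises = chain-stabilises seq (statementsBelow (bound N)) seq-ascending
    (λ i s s∈seq → InS⇒∈statementsBelow N s (seq-over i s s∈seq))

  module _ (k : ℕ) (fixed : seq (suc k) ≐ seq k) where

    Fsa-fixed : ∀ L → L ⊆ₛ N → Fsa (seq k) L ≐ seq k
    Fsa-fixed L L⊆N = ⊆ᴹ-antisym
      (λ s s∈Fsa → trans (sym (fixed s)) (Fsa⊆seq-suc k L L⊆N s s∈Fsa))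
      (⊆Fsa (seq-over k) L⊆N)

    fixed-InFsa : InFsa F N (seq k)
    fixed-InFsa =
      ext F (Fsa-mem (seq-over k) (∅⊆ₛ N)) (Fsa-fixed [] (∅⊆ₛ N)) ,
      λ L L⊆N → SelfAdhesive-resp-≐ {F} {N} {L} (Fsa-fixed L L⊆N) (Fsa-selfAdhesive (seq-over k) L⊆N)

    fixed-isClosure : IsClosureSA F N 𝓜 (seq k)
    fixed-isClosure = (fixed-InFsa , 𝓜⊆seq k) , λ B B∈Fsa 𝓜⊆B → seq⊆InFsa B B∈Fsa 𝓜⊆B k

lemma5p5 : (F : CIFrame) → CopyClosed F → MargClosed F → InterClosed F
    → LiftClosed F → AsceticClosed F
    → (N : FSet) (𝓜 : Model) → OverN N 𝓜
    → (Fsa : Model → FSet → Model)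
    → (∀ A L → OverN N A → L ⊆ₛ N → IsLeastSA F N A L (Fsa A L))
    → (seq : ℕ → Model)
    → seq zero ≐ 𝓜
    → (∀ i s → s ∈ᴹ seq (suc i) ⇔ (∃ λ L → L ⊆ₛ N × s ∈ᴹ Fsa (seq i) L))
    → (∀ i → seq i ⊆ᴹ seq (suc i))
      × (∃ λ k → seq (suc k) ≐ seq k)
      × (∀ k → seq (suc k) ≐ seq k
           → (∀ j → j < k → ¬ (seq (suc j) ≐ seq j))
           → IsClosureSA F N 𝓜 (seq k))
lemma5p5 F _ _ _ _ _ N 𝓜 𝓜-over Fsa Fsa-least-sa seq seq-zero seq-suc =
  seq-ascending , seq-stabilises , λ k fixed _ → fixed-isClosure k fixed
  where open Iteration F N 𝓜 𝓜-over Fsa Fsa-least-sa seq seq-zero seq-suc
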